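{- There exists an infinite family $\mathcal{F}$ of connected graphs such that every $G\in\mathcal{F}$ satisfies $b_{\mathsf{fa}}(G)>b(G)$.
   Context: Broadcasting in a connected graph $G$: initially only a source vertex $s$ holds a message; time proceeds in synchronous rounds, and in each round every informed vertex may transmit the message to at most one of its neighbors. $b(G,s)$ is the minimum number of rounds needed to inform all vertices from source $s$ using an arbitrary (source-dependent) protocol, and $b(G)=\max_{s\in V(G)} b(G,s)$. Fully-adaptive source-oblivious model: each vertex $v$ is assigned a single ordered list $\ell_v$ of distinct neighbors of $v$ (independent of the source). Once $v$ is informed, in each subsequent round it sends the message to the first vertex of $\ell_v$ that is not already informed at the start of that round (informed neighbors are skipped); $v$ stops when all vertices in its list are informed. For lists $L=(\ell_v)_{v\in V(G)}$ and source $s$, $b_{\mathsf{fa}}(G,s,L)$ is the number of rounds until all vertices are informed, and $b_{\mathsf{fa}}(G)=\min_L\max_{s\in V(G)} b_{\mathsf{fa}}(G,s,L)$. -}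

module Defs where

open import Data.Nat using (ℕ; zero; suc)
open import Data.Fin using (Fin; _≟_)
open import Data.Bool using (Bool; true; false; _∧_; _∨_; not; if_then_else_)
open import Data.Maybe using (Maybe; just; nothing)
open import Data.List using (List; []; _∷_)
open import Data.Vec using (Vec; []; _∷_)
open import Data.Product using (Σ; _×_; _,_)
open import Data.List.Relation.Unary.All using (All)
open import Data.List.Relation.Unary.Unique.Propositional using (Unique)
open import Relation.Nullary.Decidable using (⌊_⌋)
open import Relation.Binary.PropositionalEquality using (_≡_)

record Graph (n : ℕ) : Set where
  field
    adj     : Fin n → Fin n → Bool
    symm    : ∀ u v → adj u v ≡ adj v u
    irrefl  : ∀ v → adj v v ≡ false
open Graph public

data Reachable {n : ℕ} (G : Graph n) : Fin n → Fin n → Set where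
  here : ∀ {v} → Reachable G v v
  step : ∀ {u w v} → adj G u w ≡ true → Reachable G w v → Reachable G u v

Connected : {n : ℕ} → Graph n → Set
Connected G = ∀ u v → Reachable G u v

anyFin : {n : ℕ} → (Fin n → Bool) → Bool
anyFin {zero}  f = false
anyFin {suc n} f = f Fin.zero ∨ anyFin (λ i → f (Fin.suc i))

Informed : ℕ → Set
Informed n = Fin n → Bool

initial : {n : ℕ} → Fin n → Informed n
initial s v = ⌊ v ≟ s ⌋

AllInformed : {n : ℕ} → Informed n → Set
AllInformed I = ∀ v → I v ≡ true

Round : ℕ → Set
Round n = Fin n → Maybe (Fin n)

sendsTo : {n : ℕ} → Maybe (Fin n) → Fin n → Bool
sendsTo nothing  w = false
sendsTo (just u) w = ⌊ u ≟ w ⌋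

-- One synchronous round: a vertex informed at the start of the round
-- transmits to its chosen target (if any).
applyRound : {n : ℕ} → Round n → Informed n → Informed n
applyRound r I w = I w ∨ anyFin (λ v → I v ∧ sendsTo (r v) w)

ValidRound : {n : ℕ} → Graph n → Round n → Set
ValidRound G r = ∀ v w → r v ≡ just w → adj G v w ≡ true

ValidProtocol : {n k : ℕ} → Graph n → Vec (Round n) k → Set
ValidProtocol G []       = Data.Unit.⊤ where import Data.Unit
ValidProtocol G (r ∷ rs) = ValidRound G r × ValidProtocol G rs

runProtocol : {n k : ℕ} → Vec (Round n) k → Informed n → Informed n
runProtocol []       I = I
runProtocol (r ∷ rs) I = runProtocol rs (applyRound r I)

-- b(G,s) ≤ k : some (source-dependent) protocol informs everyone within k rounds.
BroadcastWithin : {n : ℕ} → Graph n → Fin n → ℕ → Set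
BroadcastWithin {n} G s k =
  Σ (Vec (Round n) k) λ P → ValidProtocol G P × AllInformed (runProtocol P (initial s))

-- b(G) ≤ k
BroadcastTimeAtMost : {n : ℕ} → Graph n → ℕ → Set
BroadcastTimeAtMost G k = ∀ s → BroadcastWithin G s k

Lists : ℕ → Set
Lists n = Fin n → List (Fin n)

ValidLists : {n : ℕ} → Graph n → Lists n → Set
ValidLists G L = ∀ v → Unique (L v) × All (λ w → adj G v w ≡ true) (L v)

firstUninformed : {n : ℕ} → Informed n → List (Fin n) → Maybe (Fin n)
firstUninformed I []       = nothing
firstUninformed I (w ∷ ws) = if I w then firstUninformed I ws else just w

faRound : {n : ℕ} → Lists n → Informed n → Round n
faRound L I v = firstUninformed I (L v)

faRun : {n : ℕ} → Lists n → ℕ → Informed n → Informed n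
faRun L zero    I = I
faRun L (suc k) I = faRun L k (applyRound (faRound L I) I)

-- b_fa(G,s,L) ≤ k
FAWithin : {n : ℕ} → Lists n → Fin n → ℕ → Set
FAWithin L s k = AllInformed (faRun L k (initial s))

-- b_fa(G) ≤ k : some valid lists work for every source within k rounds.
FABroadcastTimeAtMost : {n : ℕ} → Graph n → ℕ → Set
FABroadcastTimeAtMost {n} G k =
  Σ (Lists n) λ L → ValidLists G L × (∀ s → FAWithin L s k)

-- The family is the windmill graphs: m triangles sharing one centre.  With a
-- source-dependent protocol every source finishes within m + 1 rounds: the
-- centre calls one triangle per round and every informed leaf calls its
-- partner.  With fixed lists, let u be the first entry of the centre's list
-- and start at u's partner.  The source can inform only one of u and the
-- centre in round 1, so in round 2 the centre spends its call on u, and after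
-- two rounds only u's triangle holds the message.  Since the centre is the only
-- link between triangles, at most one new triangle is reached per round, and a
-- triangle whose two leaves are both first informed in the same round must
-- already have been reached.  Hence m + 1 rounds are not enough once m ≥ 2.
module Submission where

open import Data.Bool using (Bool; true; false; not; _∧_; _∨_; _xor_; if_then_else_)
open import Data.Bool.Properties using (xor-comm; xor-same; xor-inverseʳ; ∧-zeroʳ; ∨-zeroʳ; not-¬; ¬-not)
open import Data.Empty using (⊥)
open import Data.Fin as Fin using (Fin; _≟_; _↑ˡ_; _↑ʳ_; splitAt; toℕ; fromℕ<; punchIn; punchOut)
open import Data.Fin.Properties using (splitAt-↑ˡ; splitAt-↑ʳ; splitAt⁻¹-↑ˡ; splitAt⁻¹-↑ʳ; fromℕ<-toℕ; toℕ<n; punchIn-punchOut)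
open import Data.Fin.Subset using (Subset; outside; inside; _∈_; _⊆_; _∪_; ⁅_⁆; ⊤; ∣_∣)
open import Data.Fin.Subset.Properties using (p⊆q⇒∣p∣≤∣q∣; p⊆p∪q; q⊆p∪q; x∈⁅x⁆; ∣⁅x⁆∣≡1; ∣⊤∣≡n)
open import Data.List using ([]; _∷_)
open import Data.List.Relation.Unary.All as All using (All; _∷_)
open import Data.Maybe as Maybe using (Maybe; just; nothing)
open import Data.Maybe.Properties using (just-injective)
open import Data.Nat using (ℕ; zero; suc; _+_; _≤_; _≤′_; ≤′-refl; ≤′-step; z≤n; s≤s; _<?_)
open import Data.Nat.Properties
  using (≤-refl; ≤-trans; ≤-reflexive; m≤n⇒m≤1+n; n≤1+n; m≤m+n; +-suc; +-comm; +-identityʳ; +-monoʳ-≤; 1+n≰n; ≤⇒≤′; module ≤-Reasoning)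
open import Data.Product using (Σ; ∃; ∃₂; _×_; _,_; proj₁; proj₂)
open import Data.Sum using (_⊎_; inj₁; inj₂)
open import Data.Unit using (tt)
open import Data.Vec using (Vec; []; _∷_; tabulate)
open import Data.Vec.Properties using (lookup∘tabulate; lookup⇒[]=; []=⇒lookup)
open import Function using (_∘_; id)
open import Relation.Nullary using (¬_; yes; no; contradiction)
open import Relation.Nullary.Decidable using (⌊_⌋)
open import Relation.Binary.PropositionalEquality

open import Defs

∨≡true⇒ : ∀ {a b} → a ∨ b ≡ true → a ≡ true ⊎ b ≡ true
∨≡true⇒ {true}  _ = inj₁ refl
∨≡true⇒ {false} e = inj₂ e

∧≡true⇒ : ∀ {a b} → a ∧ b ≡ true → a ≡ true × b ≡ true
∧≡true⇒ {true} {true} _ = refl , refl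

xor≡true⇒ : ∀ {a b} → a xor b ≡ true → a ≡ not b
xor≡true⇒ {true}  {false} _ = refl
xor≡true⇒ {false} {true}  _ = refl

both-values : ∀ {P : Bool → Set} b → P b → P (not b) → ∀ c → P c
both-values true  pb _   true  = pb
both-values true  _  pnb false = pnb
both-values false _  pnb true  = pnb
both-values false pb _   false = pb

≟-refl : ∀ {n} (i : Fin n) → ⌊ i ≟ i ⌋ ≡ true
≟-refl i with i ≟ i
... | yes _   = refl
... | no  i≢i = contradiction refl i≢i

≟⇒≡ : ∀ {n} {i j : Fin n} → ⌊ i ≟ j ⌋ ≡ true → i ≡ j
≟⇒≡ {i = i} {j} e with i ≟ j
... | yes i≡j = i≡j

≟-sym : ∀ {n} (i j : Fin n) → ⌊ i ≟ j ⌋ ≡ ⌊ j ≟ i ⌋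
≟-sym i j with i ≟ j | j ≟ i
... | yes _   | yes _   = refl
... | no  _   | no  _   = refl
... | yes i≡j | no  j≢i = contradiction (sym i≡j) j≢i
... | no  i≢j | yes j≡i = contradiction (sym j≡i) i≢j

anyFin⇒∃ : ∀ {n} (f : Fin n → Bool) → anyFin f ≡ true → ∃ λ v → f v ≡ true
anyFin⇒∃ {suc n} f e with f Fin.zero in f0
... | true  = Fin.zero , f0
... | false with anyFin⇒∃ (f ∘ Fin.suc) e
...   | v , fv = Fin.suc v , fv

∃⇒anyFin : ∀ {n} (f : Fin n → Bool) v → f v ≡ true → anyFin f ≡ true
∃⇒anyFin f Fin.zero    fv rewrite fv = refl
∃⇒anyFin f (Fin.suc v) fv with f Fin.zero
... | true  = refl
... | false = ∃⇒anyFin (f ∘ Fin.suc) v fv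

∣p∪q∣≤∣p∣+∣q∣ : ∀ {n} (p q : Subset n) → ∣ p ∪ q ∣ ≤ ∣ p ∣ + ∣ q ∣
∣p∪q∣≤∣p∣+∣q∣ []            []            = z≤n
∣p∪q∣≤∣p∣+∣q∣ (outside ∷ p) (outside ∷ q) = ∣p∪q∣≤∣p∣+∣q∣ p q
∣p∪q∣≤∣p∣+∣q∣ (inside  ∷ p) (outside ∷ q) = s≤s (∣p∪q∣≤∣p∣+∣q∣ p q)
∣p∪q∣≤∣p∣+∣q∣ (outside ∷ p) (inside  ∷ q) =
  ≤-trans (s≤s (∣p∪q∣≤∣p∣+∣q∣ p q)) (≤-reflexive (sym (+-suc ∣ p ∣ ∣ q ∣)))
∣p∪q∣≤∣p∣+∣q∣ (inside  ∷ p) (inside  ∷ q) =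
  s≤s (≤-trans (m≤n⇒m≤1+n (∣p∪q∣≤∣p∣+∣q∣ p q)) (≤-reflexive (sym (+-suc ∣ p ∣ ∣ q ∣))))

∣p∪⁅x⁆∣≤1+∣p∣ : ∀ {n} (p : Subset n) x → ∣ p ∪ ⁅ x ⁆ ∣ ≤ suc ∣ p ∣
∣p∪⁅x⁆∣≤1+∣p∣ p x = begin
  ∣ p ∪ ⁅ x ⁆ ∣       ≤⟨ ∣p∪q∣≤∣p∣+∣q∣ p ⁅ x ⁆ ⟩
  ∣ p ∣ + ∣ ⁅ x ⁆ ∣   ≡⟨ cong (∣ p ∣ +_) (∣⁅x⁆∣≡1 x) ⟩
  ∣ p ∣ + 1           ≡⟨ +-comm ∣ p ∣ 1 ⟩
  suc ∣ p ∣           ∎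
  where open ≤-Reasoning

enumerate : ∀ {n} → ℕ → Maybe (Fin n)
enumerate {n} t with t <? n
... | yes t<n = just (fromℕ< t<n)
... | no  _   = nothing

enumerate-toℕ : ∀ {n} (i : Fin n) → enumerate (toℕ i) ≡ just i
enumerate-toℕ {n} i with toℕ i <? n
... | yes i<n = cong just (fromℕ<-toℕ i i<n)
... | no  i≮n = contradiction (toℕ<n i) i≮n

enumerateExcept : ∀ {n} → Fin (suc n) → ℕ → Maybe (Fin (suc n))
enumerateExcept j t = Maybe.map (punchIn j) (enumerate t)

enumerateExcept-punchOut : ∀ {n} {j i : Fin (suc n)} (j≢i : j ≢ i) →
                           enumerateExcept j (toℕ (punchOut j≢i)) ≡ just i
enumerateExcept-punchOut {j = j} j≢i =
  trans (cong (Maybe.map (punchIn j)) (enumerate-toℕ (punchOut j≢i)))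
        (cong just (punchIn-punchOut j≢i))

module _ {n : ℕ} where

  applyRound⇒ : ∀ (r : Round n) I w → applyRound r I w ≡ true →
                I w ≡ true ⊎ ∃ λ v → I v ≡ true × r v ≡ just w
  applyRound⇒ r I w e with ∨≡true⇒ {I w} e
  ... | inj₁ Iw     = inj₁ Iw
  ... | inj₂ called with anyFin⇒∃ _ called
  ...   | v , sent with ∧≡true⇒ {I v} sent
  ...     | Iv , to-w = inj₂ (v , Iv , sendsTo-just (r v) to-w)
    where
    sendsTo-just : ∀ x → sendsTo x w ≡ true → x ≡ just w
    sendsTo-just (just u) e = cong just (≟⇒≡ e)

  applyRound-mono : ∀ (r : Round n) I w → I w ≡ true → applyRound r I w ≡ true
  applyRound-mono r I w Iw rewrite Iw = refl

  applyRound-call : ∀ (r : Round n) I v {w} → I v ≡ true → r v ≡ just w → applyRound r I w ≡ true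
  applyRound-call r I v {w} Iv rv =
    trans (cong (I w ∨_) (∃⇒anyFin (λ u → I u ∧ sendsTo (r u) w) v sent)) (∨-zeroʳ (I w))
    where
    sent : I v ∧ sendsTo (r v) w ≡ true
    sent rewrite Iv | rv = ≟-refl w

module Schedule {n : ℕ} (R : ℕ → Round n) (s : Fin n) where

  state : ℕ → Informed n
  state zero    = initial s
  state (suc t) = applyRound (R t) (state t)

  private
    rounds : (k t : ℕ) → Vec (Round n) k
    rounds zero    t = []
    rounds (suc k) t = R t ∷ rounds k (suc t)

    runProtocol-rounds : ∀ k t → runProtocol (rounds k t) (state t) ≡ state (k + t)
    runProtocol-rounds zero    t = refl
    runProtocol-rounds (suc k) t = trans (runProtocol-rounds k (suc t)) (cong state (+-suc k t))

    rounds-valid : ∀ {G : Graph n} → (∀ t → ValidRound G (R t)) → ∀ k t → ValidProtocol G (rounds k t)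
    rounds-valid valid zero    t = tt
    rounds-valid valid (suc k) t = valid t , rounds-valid valid k (suc t)

    state-mono′ : ∀ {t t'} v → t ≤′ t' → state t v ≡ true → state t' v ≡ true
    state-mono′ v ≤′-refl                         = id
    state-mono′ {t' = suc t'} v (≤′-step t≤′t') = applyRound-mono (R t') (state t') v ∘ state-mono′ v t≤′t'

  state-mono : ∀ {t} t' v → t ≤ t' → state t v ≡ true → state t' v ≡ true
  state-mono t' v = state-mono′ v ∘ ≤⇒≤′

  state-call : ∀ t u {w} → state t u ≡ true → R t u ≡ just w → state (suc t) w ≡ true
  state-call t = applyRound-call (R t) (state t)

  broadcastWithin : ∀ {G : Graph n} {k} → (∀ t → ValidRound G (R t)) →
                    AllInformed (state k) → BroadcastWithin G s k
  broadcastWithin {k = k} valid informed =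
    rounds k 0 , rounds-valid valid k 0 ,
    λ v → subst (λ I → I v ≡ true) (sym (trans (runProtocol-rounds k 0) (cong state (+-identityʳ k))))
                (informed v)

module _ {n : ℕ} (L : Lists n) where

  faRun-suc : ∀ t I → faRun L (suc t) I ≡ applyRound (faRound L (faRun L t I)) (faRun L t I)
  faRun-suc zero    I = refl
  faRun-suc (suc t) I = faRun-suc t (applyRound (faRound L I) I)

  faRun-invariant : (P : Informed n → Set) → (∀ I → P I → P (applyRound (faRound L I) I)) →
                    ∀ t I → P I → P (faRun L t I)
  faRun-invariant P preserved zero    I PI = PI
  faRun-invariant P preserved (suc t) I PI = faRun-invariant P preserved t _ (preserved I PI)

  faRun-growth : (f : Informed n → ℕ) → (∀ I → f (applyRound (faRound L I) I) ≤ suc (f I)) →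
                 ∀ t I → f (faRun L t I) ≤ t + f I
  faRun-growth f grows zero    I = ≤-refl
  faRun-growth f grows (suc t) I = begin
    f (faRun L t I′)  ≤⟨ faRun-growth f grows t I′ ⟩
    t + f I′          ≤⟨ +-monoʳ-≤ t (grows I) ⟩
    t + suc (f I)     ≡⟨ +-suc t (f I) ⟩
    suc (t + f I)     ∎
    where
    open ≤-Reasoning
    I′ = applyRound (faRound L I) I

firstUninformed-All : ∀ {n} {P : Fin n → Set} (I : Informed n) {xs w} →
                      All P xs → firstUninformed I xs ≡ just w → P w
firstUninformed-All {P = P} I {x ∷ xs} (px ∷ pxs) e with I x
... | true  = firstUninformed-All I pxs e
... | false = subst P (just-injective e) px

faRound-valid : ∀ {n} {G : Graph n} {L : Lists n} → ValidLists G L → ∀ I → ValidRound G (faRound L I)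
faRound-valid L-valid I v w = firstUninformed-All I (proj₂ (L-valid v))

module Windmill (m : ℕ) where

  order : ℕ
  order = suc (m + m)

  centre : Fin order
  centre = Fin.zero

  leaf : Fin m → Bool → Fin order
  leaf i false = Fin.suc (i ↑ˡ m)
  leaf i true  = Fin.suc (m ↑ʳ i)

  private
    side : Fin m ⊎ Fin m → Fin m × Bool
    side (inj₁ i) = i , false
    side (inj₂ i) = i , true

  position : Fin order → Maybe (Fin m × Bool)
  position Fin.zero    = nothing
  position (Fin.suc k) = just (side (splitAt m k))

  position-leaf : ∀ i b → position (leaf i b) ≡ just (i , b)
  position-leaf i false = cong (just ∘ side) (splitAt-↑ˡ m i m)
  position-leaf i true  = cong (just ∘ side) (splitAt-↑ʳ m m i)

  data View : Fin order → Set where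
    centreᵛ : View centre
    leafᵛ   : ∀ i b → View (leaf i b)

  view : ∀ v → View v
  view Fin.zero = centreᵛ
  view (Fin.suc k) with splitAt m k in eq
  ... | inj₁ i = subst (View ∘ Fin.suc) (splitAt⁻¹-↑ˡ eq) (leafᵛ i false)
  ... | inj₂ i = subst (View ∘ Fin.suc) (splitAt⁻¹-↑ʳ eq) (leafᵛ i true)

  leaf-injective : ∀ i b j c → leaf i b ≡ leaf j c → i ≡ j × b ≡ c
  leaf-injective i b j c e
    with trans (sym (position-leaf i b)) (trans (cong position e) (position-leaf j c))
  ... | refl = refl , refl

  leaf≢centre : ∀ i b → leaf i b ≢ centre
  leaf≢centre i false ()
  leaf≢centre i true  ()

  adjacent : Maybe (Fin m × Bool) → Maybe (Fin m × Bool) → Bool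
  adjacent nothing        nothing        = false
  adjacent nothing        (just _)       = true
  adjacent (just _)       nothing        = true
  adjacent (just (i , b)) (just (j , c)) = ⌊ i ≟ j ⌋ ∧ (b xor c)

  private
    adjacent-sym : ∀ x y → adjacent x y ≡ adjacent y x
    adjacent-sym nothing        nothing        = refl
    adjacent-sym nothing        (just _)       = refl
    adjacent-sym (just _)       nothing        = refl
    adjacent-sym (just (i , b)) (just (j , c)) = cong₂ _∧_ (≟-sym i j) (xor-comm b c)

    adjacent-irrefl : ∀ x → adjacent x x ≡ false
    adjacent-irrefl nothing        = refl
    adjacent-irrefl (just (i , b)) rewrite xor-same b = ∧-zeroʳ _

  windmill : Graph order
  windmill = record
    { adj    = λ u v → adjacent (position u) (position v)
    ; symm   = λ u v → adjacent-sym (position u) (position v)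
    ; irrefl = λ v → adjacent-irrefl (position v)
    }

  centre-leaf : ∀ i b → adj windmill centre (leaf i b) ≡ true
  centre-leaf i b rewrite position-leaf i b = refl

  leaf-centre : ∀ i b → adj windmill (leaf i b) centre ≡ true
  leaf-centre i b rewrite position-leaf i b = refl

  leaf-partner : ∀ i b → adj windmill (leaf i b) (leaf i (not b)) ≡ true
  leaf-partner i b rewrite position-leaf i b | position-leaf i (not b) | ≟-refl i = xor-inverseʳ b

  centre-neighbour : ∀ u → adj windmill centre u ≡ true → ∃₂ λ i b → u ≡ leaf i b
  centre-neighbour u e with view u
  ... | centreᵛ   = contradiction e λ ()
  ... | leafᵛ i b = i , b , refl

  leaf-neighbour : ∀ u i b → adj windmill u (leaf i b) ≡ true → u ≡ centre ⊎ u ≡ leaf i (not b)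
  leaf-neighbour u i b e with view u
  ... | centreᵛ = inj₁ refl
  ... | leafᵛ j c rewrite position-leaf j c | position-leaf i b with ∧≡true⇒ {⌊ j ≟ i ⌋} e
  ...   | same-triangle , other-side with ≟⇒≡ same-triangle | xor≡true⇒ {c} other-side
  ...     | refl | refl = inj₂ refl

  windmill-connected : Connected windmill
  windmill-connected u v with view u | view v
  ... | centreᵛ   | centreᵛ   = here
  ... | centreᵛ   | leafᵛ i b = step (centre-leaf i b) here
  ... | leafᵛ i b | centreᵛ   = step (leaf-centre i b) here
  ... | leafᵛ i b | leafᵛ j c = step (leaf-centre i b) (step (centre-leaf j c) here)

  relayRound : Maybe (Fin m) → Round order
  relayRound c v = relay (position v)
    where
    relay : Maybe (Fin m × Bool) → Maybe (Fin order)
    relay nothing        = Maybe.map (λ i → leaf i false) c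
    relay (just (i , b)) = just (leaf i (not b))

  relayRound-leaf : ∀ c i b → relayRound c (leaf i b) ≡ just (leaf i (not b))
  relayRound-leaf c i b rewrite position-leaf i b = refl

  relayRound-valid : ∀ c → ValidRound windmill (relayRound c)
  relayRound-valid c v w e with view v
  relayRound-valid (just i) _ _ refl | centreᵛ = centre-leaf i false
  ... | leafᵛ i b with trans (sym (relayRound-leaf c i b)) e
  ...   | refl = leaf-partner i b

  towardsCentre : Round order
  towardsCentre v = Maybe.map (λ _ → centre) (position v)

  towardsCentre-leaf : ∀ i b → towardsCentre (leaf i b) ≡ just centre
  towardsCentre-leaf i b rewrite position-leaf i b = refl

  towardsCentre-valid : ValidRound windmill towardsCentre
  towardsCentre-valid v w e with view v
  ... | leafᵛ i b with trans (sym (towardsCentre-leaf i b)) e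
  ...   | refl = leaf-centre i b

module WindmillBroadcast (m : ℕ) where
  open Windmill (suc m)

  module _ {R : ℕ → Round order} {s : Fin order} where
    open Schedule R s

    triangle-informed : ∀ t i → state t centre ≡ true → R t centre ≡ just (leaf i false) →
                     R (suc t) (leaf i false) ≡ just (leaf i true) →
                     ∀ b → state (suc (suc t)) (leaf i b) ≡ true
    triangle-informed t i centre-informed calls-leaf calls-partner false =
      state-mono (suc (suc t)) (leaf i false) (n≤1+n _) (state-call t centre centre-informed calls-leaf)
    triangle-informed t i centre-informed calls-leaf calls-partner true =
      state-call (suc t) (leaf i false) (state-call t centre centre-informed calls-leaf) calls-partner

  fromCentre : BroadcastWithin windmill centre (suc (suc m))
  fromCentre = broadcastWithin (relayRound-valid ∘ enumerate) informed
    where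
    open Schedule (relayRound ∘ enumerate) centre
    informed : AllInformed (state (suc (suc m)))
    informed v with view v
    ... | centreᵛ   = state-mono (suc (suc m)) centre z≤n (≟-refl centre)
    ... | leafᵛ i b =
      state-mono (suc (suc m)) (leaf i b) (s≤s (toℕ<n i))
        (triangle-informed (toℕ i) i (state-mono (toℕ i) centre z≤n (≟-refl centre))
                        (cong (Maybe.map (λ i → leaf i false)) (enumerate-toℕ i))
                        (relayRound-leaf (enumerate (suc (toℕ i))) i false) b)

  fromLeaf : ∀ j β → BroadcastWithin windmill (leaf j β) (suc (suc m))
  fromLeaf j β = broadcastWithin valid informed
    where
    schedule : ℕ → Round order
    schedule zero    = towardsCentre
    schedule (suc t) = relayRound (enumerateExcept j t)

    valid : ∀ t → ValidRound windmill (schedule t)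
    valid zero    = towardsCentre-valid
    valid (suc t) = relayRound-valid _

    open Schedule schedule (leaf j β)

    source-informed : ∀ t → state t (leaf j β) ≡ true
    source-informed t = state-mono t (leaf j β) z≤n (≟-refl (leaf j β))

    centre-informed : ∀ t → 1 ≤ t → state t centre ≡ true
    centre-informed t 1≤t =
      state-mono t centre 1≤t (state-call 0 (leaf j β) (source-informed 0) (towardsCentre-leaf j β))

    own-triangle : ∀ c → state 2 (leaf j c) ≡ true
    own-triangle = both-values β (source-informed 2)
      (state-call 1 (leaf j β) (source-informed 1) (relayRound-leaf (enumerateExcept j 0) j β))

    other-triangle : ∀ {i} (j≢i : j ≢ i) c → state (3 + toℕ (punchOut j≢i)) (leaf i c) ≡ true
    other-triangle {i} j≢i = triangle-informed t i (centre-informed t (s≤s z≤n))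
      (cong (Maybe.map (λ i → leaf i false)) (enumerateExcept-punchOut j≢i))
      (relayRound-leaf (enumerateExcept j t) i false)
      where
      t = suc (toℕ (punchOut j≢i))

    informed : AllInformed (state (suc (suc m)))
    informed v with view v
    ... | centreᵛ = centre-informed (suc (suc m)) (s≤s z≤n)
    ... | leafᵛ i c with j ≟ i
    ...   | yes refl = state-mono (suc (suc m)) (leaf i c) (s≤s (s≤s z≤n)) (own-triangle c)
    ...   | no  j≢i  =
      state-mono (suc (suc m)) (leaf i c) (s≤s (s≤s (toℕ<n (punchOut j≢i)))) (other-triangle j≢i c)

  windmill-broadcastTime : BroadcastTimeAtMost windmill (suc (suc m))
  windmill-broadcastTime v with view v
  ... | centreᵛ   = fromCentre
  ... | leafᵛ j β = fromLeaf j β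

module WindmillListsLowerBound (p : ℕ) where
  open Windmill (suc (suc p))

  module _ {L : Lists order} (L-valid : ValidLists windmill L) where

    calls-adjacent : ∀ I → ValidRound windmill (faRound L I)
    calls-adjacent = faRound-valid {G = windmill} {L = L} L-valid

    next : Informed order → Informed order
    next I = applyRound (faRound L I) I

    reached : Informed order → Fin (suc (suc p)) → Bool
    reached I i = I (leaf i false) ∨ I (leaf i true)

    touched : Informed order → Subset (suc (suc p))
    touched I = tabulate (reached I)

    ∈-touched : ∀ I {i} b → I (leaf i b) ≡ true → i ∈ touched I
    ∈-touched I {i} b e =
      lookup⇒[]= i (touched I) (trans (lookup∘tabulate (reached I) i) (either b e))
      where
      either : ∀ b → I (leaf i b) ≡ true → I (leaf i false) ∨ I (leaf i true) ≡ true
      either false e rewrite e = refl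
      either true  e rewrite e = ∨-zeroʳ _

    ∈-touched⁻ : ∀ I {i} → i ∈ touched I → ∃ λ b → I (leaf i b) ≡ true
    ∈-touched⁻ I {i} i∈
      with ∨≡true⇒ {I (leaf i false)} (trans (sym (lookup∘tabulate (reached I) i)) ([]=⇒lookup i∈))
    ... | inj₁ e = false , e
    ... | inj₂ e = true  , e

    leaf≡⇒∈⁅⁆ : ∀ i b j c → leaf i b ≡ leaf j c → i ∈ ⁅ j ⁆
    leaf≡⇒∈⁅⁆ i b j c e = subst (_∈ ⁅ j ⁆) (sym (proj₁ (leaf-injective i b j c e))) (x∈⁅x⁆ j)

    newly-informed-leaf : ∀ I i b → next I (leaf i b) ≡ true →
                          i ∈ touched I ⊎ I centre ≡ true × faRound L I centre ≡ just (leaf i b)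
    newly-informed-leaf I i b e with applyRound⇒ (faRound L I) I _ e
    ... | inj₁ informed = inj₁ (∈-touched I b informed)
    ... | inj₂ (u , Iu , call) with leaf-neighbour u i b (calls-adjacent I u _ call)
    ...   | inj₁ refl = inj₂ (Iu , call)
    ...   | inj₂ refl = inj₁ (∈-touched I (not b) Iu)

    touched-next-⊆ : ∀ I {X} → touched I ⊆ X →
                     (∀ {i b} → I centre ≡ true → faRound L I centre ≡ just (leaf i b) → i ∈ X) →
                     touched (next I) ⊆ X
    touched-next-⊆ I old centre-call {i} i∈ with ∈-touched⁻ (next I) i∈
    ... | b , e with newly-informed-leaf I i b e
    ...   | inj₁ i∈old         = old i∈old
    ...   | inj₂ (Ic , called) = centre-call Ic called

    -- Only the centre joins different triangles, and it makes one call per round.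
    ∣touched-next∣≤ : ∀ I → ∣ touched (next I) ∣ ≤ suc ∣ touched I ∣
    ∣touched-next∣≤ I = by-centre-call (faRound L I centre) refl
      where
      by-centre-call : ∀ c → faRound L I centre ≡ c → ∣ touched (next I) ∣ ≤ suc ∣ touched I ∣
      by-centre-call nothing call =
        m≤n⇒m≤1+n (p⊆q⇒∣p∣≤∣q∣ (touched-next-⊆ I id λ _ e → contradiction (trans (sym call) e) λ ()))
      by-centre-call (just w) call with centre-neighbour w (calls-adjacent I centre w call)
      ... | j , c , refl =
        ≤-trans (p⊆q⇒∣p∣≤∣q∣ (touched-next-⊆ I (p⊆p∪q ⁅ j ⁆) new)) (∣p∪⁅x⁆∣≤1+∣p∣ (touched I) j)
        where
        new : ∀ {i b} → I centre ≡ true → faRound L I centre ≡ just (leaf i b) → i ∈ touched I ∪ ⁅ j ⁆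
        new {i} {b} _ e =
          q⊆p∪q (touched I) ⁅ j ⁆ (leaf≡⇒∈⁅⁆ i b j c (just-injective (trans (sym e) call)))

    -- The centre cannot inform both leaves of a triangle in the same round.
    both-leaves-new⇒touched : ∀ I {i} → next I (leaf i false) ≡ true → next I (leaf i true) ≡ true →
                              i ∈ touched I
    both-leaves-new⇒touched I {i} e₁ e₂
      with newly-informed-leaf I i false e₁ | newly-informed-leaf I i true e₂
    ... | inj₁ i∈         | _                = i∈
    ... | inj₂ _          | inj₁ i∈          = i∈
    ... | inj₂ (_ , call₁) | inj₂ (_ , call₂) =
      contradiction (proj₂ (leaf-injective i false i true (just-injective (trans (sym call₁) call₂)))) λ ()

    silent-centre : L centre ≡ [] → ∀ t → ¬ FAWithin L centre t
    silent-centre no-calls t all-informed =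
      leaf≢centre Fin.zero false
        (faRun-invariant L OnlyCentre preserved t (initial centre) (λ v → ≟⇒≡ {i = v})
           (leaf Fin.zero false) (all-informed (leaf Fin.zero false)))
      where
      OnlyCentre : Informed order → Set
      OnlyCentre I = ∀ v → I v ≡ true → v ≡ centre
      preserved : ∀ I → OnlyCentre I → OnlyCentre (next I)
      preserved I only v e with applyRound⇒ (faRound L I) I v e
      ... | inj₁ informed = only v informed
      ... | inj₂ (u , Iu , call) with only u Iu
      ...   | refl = contradiction (trans (sym call) (cong (firstUninformed I) no-calls)) λ ()

    partner-of-first : ∀ {j β rest} → L centre ≡ leaf j β ∷ rest →
                       ¬ FAWithin L (leaf j (not β)) (suc (suc (suc p)))
    partner-of-first {j} {β} {rest} first all-informed = 1+n≰n bound
      where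
      source = leaf j (not β)
      I₀ = initial source
      I₁ = next I₀
      I₂ = next I₁

      called-by-source : ∀ v → I₁ v ≡ true → v ≢ source → faRound L I₀ source ≡ just v
      called-by-source v e v≢source with applyRound⇒ (faRound L I₀) I₀ v e
      ... | inj₁ informed = contradiction (≟⇒≡ informed) v≢source
      ... | inj₂ (u , Iu , call) with ≟⇒≡ {i = u} Iu
      ...   | refl = call

      not-both : I₁ centre ≡ true → I₁ (leaf j β) ≢ true
      not-both c f = leaf≢centre j β (sym (just-injective (trans
        (sym (called-by-source centre c (leaf≢centre j (not β) ∘ sym)))
        (called-by-source (leaf j β) f (not-¬ refl ∘ proj₂ ∘ leaf-injective j β j (not β))))))

      centre-calls-first : I₁ centre ≡ true → faRound L I₁ centre ≡ just (leaf j β)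
      centre-calls-first c = begin
        faRound L I₁ centre                       ≡⟨ cong (firstUninformed I₁) first ⟩
        (if I₁ (leaf j β) then later else called) ≡⟨ cong (if_then later else called) (¬-not (not-both c)) ⟩
        called                                    ∎
        where
        open ≡-Reasoning
        later = firstUninformed I₁ rest
        called = just (leaf j β)

      touched₀ : touched I₀ ⊆ ⁅ j ⁆
      touched₀ {i} i∈ with ∈-touched⁻ I₀ i∈
      ... | b , e = leaf≡⇒∈⁅⁆ i b j (not β) (≟⇒≡ e)

      touched₂ : touched I₂ ⊆ ⁅ j ⁆
      touched₂ = touched-next-⊆ I₁
        (touched-next-⊆ I₀ touched₀ λ c _ → contradiction (≟⇒≡ c) (leaf≢centre j (not β) ∘ sym))
        λ {i} {b} c e → leaf≡⇒∈⁅⁆ i b j β (just-injective (trans (sym e) (centre-calls-first c)))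

      Iₑ = faRun L (suc (suc p)) I₀

      everything-touched : ⊤ ⊆ touched Iₑ
      everything-touched {i} _ =
        both-leaves-new⇒touched Iₑ (informed-at-end (leaf i false)) (informed-at-end (leaf i true))
        where
        informed-at-end : ∀ v → next Iₑ v ≡ true
        informed-at-end v = subst (λ I → I v ≡ true) (faRun-suc L (suc (suc p)) I₀) (all-informed v)

      bound : suc (suc p) ≤ suc p
      bound = begin
        suc (suc p)                ≡⟨ sym (∣⊤∣≡n (suc (suc p))) ⟩
        ∣ ⊤ {suc (suc p)} ∣        ≤⟨ p⊆q⇒∣p∣≤∣q∣ everything-touched ⟩
        ∣ touched (faRun L p I₂) ∣ ≤⟨ faRun-growth L (∣_∣ ∘ touched) ∣touched-next∣≤ p I₂ ⟩
        p + ∣ touched I₂ ∣         ≤⟨ +-monoʳ-≤ p (p⊆q⇒∣p∣≤∣q∣ touched₂) ⟩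
        p + ∣ ⁅ j ⁆ ∣              ≡⟨ cong (p +_) (∣⁅x⁆∣≡1 j) ⟩
        p + 1                      ≡⟨ +-comm p 1 ⟩
        suc p                      ∎
        where open ≤-Reasoning

  windmill-no-fast-lists : ¬ FABroadcastTimeAtMost windmill (suc (suc (suc p)))
  windmill-no-fast-lists (L , L-valid , fast) = by-centre-list (L centre) refl
    where
    by-centre-list : ∀ xs → L centre ≡ xs → ⊥
    by-centre-list []       first = silent-centre L-valid first (suc (suc (suc p))) (fast centre)
    by-centre-list (w ∷ ws) first
      with centre-neighbour w (All.head (subst (All _) first (proj₂ (L-valid centre))))
    ... | j , β , refl = partner-of-first L-valid first (fast (leaf j (not β)))

proposition2 : (N : ℕ) → Σ ℕ λ n → N ≤ n × Σ (Graph n) λ G → Connected G ×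
                 Σ ℕ λ k → BroadcastTimeAtMost G k × ¬ FABroadcastTimeAtMost G k
proposition2 N =
  order , N≤order , windmill , windmill-connected ,
  suc (suc (suc N)) , windmill-broadcastTime , windmill-no-fast-lists
  where
  open Windmill (suc (suc N))
  open WindmillBroadcast (suc N)
  open WindmillListsLowerBound N
  N≤order : N ≤ order
  N≤order = m≤n⇒m≤1+n (m≤n⇒m≤1+n (m≤n⇒m≤1+n (m≤m+n N (suc (suc N)))))
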